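{- Let $N\ge1$ and $X=\{1,\dots,N\}$. If every full admissible type on $X$ is realizable, then every admissible type on $X$ is realizable.
   Context: A shape is a multiset of nonnegative integers whose sum is at most $N$; for a shape $M$ and integer $x$, $\mu_M(x)$ is the number of entries of $M$ equal to $x$. A type is a multiset of shapes $\{M_1,\dots,M_k\}$. It is admissible if $\sum_{i=1}^k\mu_{M_i}(x)\le\binom{N}{x}$ for all $0\le x\le N$, and full if equality holds for all $0\le x\le N$. For $\mathcal S\subseteq\mathcal P(X)$, a partial spread in $\mathcal S$ is a subset $\mathcal C\subseteq\mathcal S$ any two distinct members of which are disjoint; its shape is $\{|C|:C\in\mathcal C\}$. A disjoint partial spread system on $\mathcal S$ is a partition of $\mathcal S$ into partial spreads, and its type is the multiset of the shapes of its partial spreads. A type is realizable if it is the type of a disjoint partial spread system on some $\mathcal S\subseteq\mathcal P(X)$. -}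

module Defs where

open import Data.Nat using (ℕ; _≤_; _≟_)
open import Data.Nat.Combinatorics using (_C_)
open import Data.List using (List; map; filter; length; concat)
open import Data.Nat.ListAction using (sum)
open import Data.List.Relation.Unary.All using (All)
open import Data.List.Relation.Unary.AllPairs using (AllPairs)
open import Data.List.Relation.Unary.Unique.Propositional using (Unique)
open import Data.List.Relation.Binary.Pointwise using (Pointwise)
open import Data.List.Relation.Binary.Permutation.Propositional using (_↭_)
open import Data.Fin.Subset using (Subset; _∩_; Empty; ∣_∣)
open import Data.Product using (Σ; _×_)
open import Relation.Binary.PropositionalEquality using (_≡_)

-- A multiset of naturals is represented by a list (order irrelevant).
-- A shape (for ground set size N): multiset of naturals with sum ≤ N.
IsShape : ℕ → List ℕ → Set
IsShape N M = sum M ≤ N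

μ : List ℕ → ℕ → ℕ
μ M x = length (filter (x ≟_) M)

IsType : ℕ → List (List ℕ) → Set
IsType N T = All (IsShape N) T

totalμ : List (List ℕ) → ℕ → ℕ
totalμ T x = sum (map (λ M → μ M x) T)

Admissible : ℕ → List (List ℕ) → Set
Admissible N T = IsType N T × (∀ x → x ≤ N → totalμ T x ≤ N C x)

Full : ℕ → List (List ℕ) → Set
Full N T = ∀ x → x ≤ N → totalμ T x ≡ N C x

-- Subsets of X = {1..N} are Subset N (characteristic vectors over Fin N).
Disjoint : ∀ {N} → Subset N → Subset N → Set
Disjoint p q = Empty (p ∩ q)

IsPartialSpread : ∀ {N} → List (Subset N) → Set
IsPartialSpread C = AllPairs Disjoint C

-- A disjoint partial spread system: a list of partial spreads whose members
-- are all distinct (so the blocks partition S = the union of the blocks).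
IsDPSS : ∀ {N} → List (List (Subset N)) → Set
IsDPSS Cs = All IsPartialSpread Cs × Unique (concat Cs)

shapeOf : ∀ {N} → List (Subset N) → List ℕ
shapeOf C = map ∣_∣ C

-- T is realizable: some disjoint partial spread system has type T
-- (as multisets: blocks matched to entries of T, each shape equal up to permutation;
-- the order of blocks is free, so this is multiset equality of types).
Realizable : (N : ℕ) → List (List ℕ) → Set
Realizable N T =
  Σ (List (List (Subset N))) λ Cs →
    IsDPSS Cs × Pointwise (λ C M → shapeOf C ↭ M) Cs T

module Submission where

open import Defs
open import Data.Nat using (ℕ; zero; suc; _+_; _*_; _∸_; _≤_; _<_; _≟_)
open import Data.Nat.Properties
  using (≤-refl; ≤-reflexive; ≤-trans; n≤1+n; ≤-pred; ≤∧≢⇒<; <-irrefl;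
         *-identityʳ; *-zeroʳ; +-identityʳ; m+[n∸m]≡n)
open import Data.Nat.Combinatorics using (_C_)
open import Data.Nat.ListAction using (sum)
open import Data.Nat.ListAction.Properties using (sum-++)
open import Data.List using (List; []; _∷_; [_]; _++_; map; replicate; concat; length)
open import Data.List.Properties using (map-++; concat-++; filter-accept; filter-reject)
import Data.List.Relation.Unary.All.Properties as All
open import Data.List.Relation.Unary.AllPairs using (AllPairs; []; _∷_)
open import Data.List.Relation.Unary.Unique.Propositional using (Unique)
open import Data.List.Relation.Binary.Pointwise using (Pointwise; []; _∷_)
open import Data.Fin.Subset using (Subset)
open import Data.Product using (_×_; _,_; ∃₂)
open import Relation.Binary.PropositionalEquality using (_≡_; refl; sym; trans; cong; subst; cong₂; module ≡-Reasoning)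
open import Relation.Nullary using (¬_; yes; no)

-- Pad an admissible type to a full one by adding binom(N,x) − Σᵢ μ_{Mᵢ}(x)
-- singleton shapes {x} for each x ≤ N.  A system realizing the padded type,
-- restricted to the blocks matched with the original shapes, realizes the
-- original type.

totalμ-++ : ∀ A B x → totalμ (A ++ B) x ≡ totalμ A x + totalμ B x
totalμ-++ A B x = begin
  sum (map (λ M → μ M x) (A ++ B))                      ≡⟨ cong sum (map-++ _ A B) ⟩
  sum (map (λ M → μ M x) A ++ map (λ M → μ M x) B)     ≡⟨ sum-++ (map _ A) _ ⟩
  totalμ A x + totalμ B x                               ∎
  where open ≡-Reasoning

totalμ-replicate : ∀ n M x → totalμ (replicate n M) x ≡ n * μ M x
totalμ-replicate zero    M x = refl
totalμ-replicate (suc n) M x = cong (μ M x +_) (totalμ-replicate n M x)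

μ-[y]-y : ∀ y → μ [ y ] y ≡ 1
μ-[y]-y y = cong length (filter-accept (y ≟_) refl)

μ-[y]-x : ∀ {x y} → ¬ x ≡ y → μ [ y ] x ≡ 0
μ-[y]-x {x} x≢y = cong length (filter-reject (x ≟_) x≢y)

singletons : (ℕ → ℕ) → ℕ → List (List ℕ)
singletons d zero    = replicate (d zero) [ zero ]
singletons d (suc k) = replicate (d (suc k)) [ suc k ] ++ singletons d k

module _ (d : ℕ → ℕ) where

  totalμ-copies-y : ∀ y → totalμ (replicate (d y) [ y ]) y ≡ d y
  totalμ-copies-y y = trans (totalμ-replicate (d y) [ y ] y)
                            (trans (cong (d y *_) (μ-[y]-y y)) (*-identityʳ (d y)))

  totalμ-copies-x : ∀ {x} y → ¬ x ≡ y → totalμ (replicate (d y) [ y ]) x ≡ 0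
  totalμ-copies-x {x} y x≢y = trans (totalμ-replicate (d y) [ y ] x)
                                    (trans (cong (d y *_) (μ-[y]-x x≢y)) (*-zeroʳ (d y)))

  totalμ-singletons-> : ∀ k x → k < x → totalμ (singletons d k) x ≡ 0
  totalμ-singletons-> zero    x k<x = totalμ-copies-x zero λ { refl → <-irrefl refl k<x }
  totalμ-singletons-> (suc k) x k<x = begin
    totalμ (replicate (d (suc k)) [ suc k ] ++ singletons d k) x
      ≡⟨ totalμ-++ (replicate (d (suc k)) [ suc k ]) (singletons d k) x ⟩
    totalμ (replicate (d (suc k)) [ suc k ]) x + totalμ (singletons d k) x
      ≡⟨ cong₂ _+_ (totalμ-copies-x (suc k) λ { refl → <-irrefl refl k<x })
                   (totalμ-singletons-> k x (≤-trans (n≤1+n (suc k)) k<x)) ⟩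
    0 ∎
    where open ≡-Reasoning

  totalμ-singletons-≤ : ∀ k x → x ≤ k → totalμ (singletons d k) x ≡ d x
  totalμ-singletons-≤ zero    zero    _   = totalμ-copies-y zero
  totalμ-singletons-≤ (suc k) x       x≤k with x ≟ suc k
  ... | yes refl = begin
    totalμ (replicate (d x) [ x ] ++ singletons d k) x
      ≡⟨ totalμ-++ (replicate (d x) [ x ]) (singletons d k) x ⟩
    totalμ (replicate (d x) [ x ]) x + totalμ (singletons d k) x
      ≡⟨ cong₂ _+_ (totalμ-copies-y x) (totalμ-singletons-> k x ≤-refl) ⟩
    d x + 0
      ≡⟨ +-identityʳ (d x) ⟩
    d x ∎
    where open ≡-Reasoning
  ... | no x≢1+k = begin
    totalμ (replicate (d (suc k)) [ suc k ] ++ singletons d k) x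
      ≡⟨ totalμ-++ (replicate (d (suc k)) [ suc k ]) (singletons d k) x ⟩
    totalμ (replicate (d (suc k)) [ suc k ]) x + totalμ (singletons d k) x
      ≡⟨ cong₂ _+_ (totalμ-copies-x (suc k) x≢1+k)
                   (totalμ-singletons-≤ k x (≤-pred (≤∧≢⇒< x≤k x≢1+k))) ⟩
    d x ∎
    where open ≡-Reasoning

  copies-isType : ∀ {N} y → y ≤ N → IsType N (replicate (d y) [ y ])
  copies-isType y y≤N = All.replicate⁺ (d y) (≤-trans (≤-reflexive (+-identityʳ y)) y≤N)

  singletons-isType : ∀ {N} k → k ≤ N → IsType N (singletons d k)
  singletons-isType zero    k≤N = copies-isType zero k≤N
  singletons-isType (suc k) k≤N =
    All.++⁺ (copies-isType (suc k) k≤N) (singletons-isType k (≤-trans (n≤1+n k) k≤N))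

AllPairs-++⁻ˡ : ∀ {A : Set} {R : A → A → Set} xs {ys} → AllPairs R (xs ++ ys) → AllPairs R xs
AllPairs-++⁻ˡ []       _          = []
AllPairs-++⁻ˡ (x ∷ xs) (px ∷ pxs) = All.++⁻ˡ xs px ∷ AllPairs-++⁻ˡ xs pxs

Pointwise-++ʳ⁻ : ∀ {A B : Set} {R : A → B → Set} {xs} ys {zs} → Pointwise R xs (ys ++ zs) →
                 ∃₂ λ xs₁ xs₂ → xs ≡ xs₁ ++ xs₂ × Pointwise R xs₁ ys × Pointwise R xs₂ zs
Pointwise-++ʳ⁻ []       rs       = [] , _ , refl , [] , rs
Pointwise-++ʳ⁻ (y ∷ ys) (r ∷ rs) with Pointwise-++ʳ⁻ ys rs
... | xs₁ , xs₂ , refl , rs₁ , rs₂ = _ ∷ xs₁ , xs₂ , refl , r ∷ rs₁ , rs₂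

IsDPSS-++⁻ˡ : ∀ {N} (Cs Ds : List (List (Subset N))) → IsDPSS (Cs ++ Ds) → IsDPSS Cs
IsDPSS-++⁻ˡ Cs Ds (spreads , unique) =
  All.++⁻ˡ Cs spreads , AllPairs-++⁻ˡ (concat Cs) (subst Unique (sym (concat-++ Cs Ds)) unique)

Realizable-++⁻ˡ : ∀ {N} T {P} → Realizable N (T ++ P) → Realizable N T
Realizable-++⁻ˡ T (Cs , dpss , matched) with Pointwise-++ʳ⁻ T matched
... | Cs₁ , Cs₂ , refl , matched₁ , _ = Cs₁ , IsDPSS-++⁻ˡ Cs₁ Cs₂ dpss , matched₁

deficit : ℕ → List (List ℕ) → ℕ → ℕ
deficit N T x = N C x ∸ totalμ T x

completion : ℕ → List (List ℕ) → List (List ℕ)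
completion N T = T ++ singletons (deficit N T) N

completion-full : ∀ {N} T → Admissible N T → Full N (completion N T)
completion-full {N} T (_ , bounded) x x≤N = begin
  totalμ (T ++ singletons (deficit N T) N) x
    ≡⟨ totalμ-++ T (singletons (deficit N T) N) x ⟩
  totalμ T x + totalμ (singletons (deficit N T) N) x
    ≡⟨ cong (totalμ T x +_) (totalμ-singletons-≤ (deficit N T) N x x≤N) ⟩
  totalμ T x + (N C x ∸ totalμ T x)
    ≡⟨ m+[n∸m]≡n (bounded x x≤N) ⟩
  N C x ∎
  where open ≡-Reasoning

completion-admissible : ∀ {N} T → Admissible N T → Admissible N (completion N T)
completion-admissible {N} T adm@(isType , _) =
  All.++⁺ isType (singletons-isType (deficit N T) N ≤-refl) ,
  λ x x≤N → ≤-reflexive (completion-full T adm x x≤N)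

lemma2p2 : (N : ℕ) → 1 ≤ N →
           ((T : List (List ℕ)) → Admissible N T × Full N T → Realizable N T) →
           (T : List (List ℕ)) → Admissible N T → Realizable N T
lemma2p2 N _ full-realizable T adm =
  Realizable-++⁻ˡ T (full-realizable (completion N T)
                                     (completion-admissible T adm , completion-full T adm))
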